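{- Let $V$ be a non-empty finite set and $R:V\times V\to 2^V$ a monotone transit function. Then $R$ satisfies axiom (uc) if and only if $R$ satisfies both axiom (u) and axiom (w), where: (uc): for all $x,y,u,v\in V$, if $R(x,y)\cap R(u,v)\neq\emptyset$ then there exist $p,q\in R(x,y)\cup R(u,v)$ such that $R(x,y)\cup R(u,v)=R(p,q)$; (u): for all $u,v,z\in V$, if $z\in R(u,v)$ then $R(u,v)=R(u,z)\cup R(z,v)$; (w): for all $x,y,z\in V$, $z\in R(x,y)$ or $y\in R(x,z)$ or $x\in R(y,z)$.
   Context: A transit function on a non-empty finite set $V$ is a map $R:V\times V\to 2^V$ such that (t1) $u\in R(u,v)$ for all $u,v$; (t2) $R(u,v)=R(v,u)$ for all $u,v$; (t3) $R(u,u)=\{u\}$ for all $u$. It is monotone if for all $u,v\in V$ and all $p,q\in R(u,v)$ one has $R(p,q)\subseteq R(u,v)$. -}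

module Defs where

open import Data.Nat using (ℕ)
open import Data.Fin using (Fin)
open import Data.Fin.Subset using (Subset; _∈_; _⊆_; _∪_; _∩_; Nonempty)
open import Data.Product using (_×_; ∃₂; _,_)
open import Data.Sum using (_⊎_)
open import Relation.Binary.PropositionalEquality using (_≡_)
open import Data.Fin.Subset using (⁅_⁆)

-- A finite set V is represented as Fin n; subsets as Data.Fin.Subset.
-- A map R : V × V → 2^V (curried).
SetMap : ℕ → Set
SetMap n = Fin n → Fin n → Subset n

IsTransit : ∀ {n} → SetMap n → Set
IsTransit {n} R =
  (∀ (u v : Fin n) → u ∈ R u v) ×
  (∀ (u v : Fin n) → R u v ≡ R v u) ×
  (∀ (u : Fin n) → R u u ≡ ⁅ u ⁆)

IsMonotone : ∀ {n} → SetMap n → Set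
IsMonotone {n} R = ∀ (u v p q : Fin n) → p ∈ R u v → q ∈ R u v → R p q ⊆ R u v

Axiom-uc : ∀ {n} → SetMap n → Set
Axiom-uc {n} R = ∀ (x y u v : Fin n) → Nonempty (R x y ∩ R u v) →
  ∃₂ λ p q → p ∈ (R x y ∪ R u v) × q ∈ (R x y ∪ R u v) × (R x y ∪ R u v ≡ R p q)

Axiom-u : ∀ {n} → SetMap n → Set
Axiom-u {n} R = ∀ (u v z : Fin n) → z ∈ R u v → R u v ≡ (R u z ∪ R z v)

Axiom-w : ∀ {n} → SetMap n → Set
Axiom-w {n} R = ∀ (x y z : Fin n) → z ∈ R x y ⊎ y ∈ R x z ⊎ x ∈ R y z

-- Monotonicity makes every interval R(u,v) convex: it contains R(p,q) for
-- all p, q in it. Under (uc) the union of two intersecting intervals is an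
-- interval, hence convex too. This yields (u) at once, and yields (w) since
-- for three points violating (w) the union R(x,y) ∪ R(x,z) = R(p,q) would
-- force p and q into a single one of the three intervals, which then
-- contains the third point. Conversely, given a common point t of R(x,y) and
-- R(u,v), axiom (w) lets us enlarge R(x,y) twice, through endpoints taken from
-- the union, to an interval R(p,q) containing u and v; by (u) at t,
-- R(p,q) = R(p,t) ∪ R(t,q), and both parts lie in the union by convexity.
module Submission where

open import Defs
open import Data.Nat using (ℕ; suc)
open import Data.Fin using (Fin)
open import Data.Fin.Subset using (Subset; _∈_; _∉_; _⊆_; _∪_; _∩_; Nonempty)
open import Data.Fin.Subset.Properties
  using (_∈?_; ⊆-reflexive; ⊆-trans; ⊆-antisym; x∈p∪q⁻; x∈p∪q⁺; x∈p∩q⁺; x∈p∩q⁻)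
open import Data.Product using (_×_; _,_; ∃₂)
open import Data.Sum using (_⊎_; inj₁; inj₂)
open import Data.Empty using (⊥)
open import Function.Bundles using (_⇔_; mk⇔)
open import Relation.Nullary using (yes; no)
open import Relation.Binary.PropositionalEquality using (_≡_; sym; subst)

module _ {n : ℕ} where

  p⊆r∧q⊆r⇒p∪q⊆r : {p q r : Subset n} → p ⊆ r → q ⊆ r → p ∪ q ⊆ r
  p⊆r∧q⊆r⇒p∪q⊆r {p} {q} p⊆r q⊆r x∈p∪q with x∈p∪q⁻ p q x∈p∪q
  ... | inj₁ x∈p = p⊆r x∈p
  ... | inj₂ x∈q = q⊆r x∈q

  pair-within-one : {A B C : Subset n} {x y : Fin n} →
    B ⊆ A ∪ C → C ⊆ A ∪ B → x ∈ B ∪ C → y ∈ B ∪ C →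
    (x ∈ A × y ∈ A) ⊎ (x ∈ B × y ∈ B) ⊎ (x ∈ C × y ∈ C)
  pair-within-one {A} {B} {C} B⊆A∪C C⊆A∪B x∈ y∈
    with x∈p∪q⁻ B C x∈ | x∈p∪q⁻ B C y∈
  ... | inj₁ x∈B | inj₁ y∈B = inj₂ (inj₁ (x∈B , y∈B))
  ... | inj₂ x∈C | inj₂ y∈C = inj₂ (inj₂ (x∈C , y∈C))
  ... | inj₁ x∈B | inj₂ y∈C with x∈p∪q⁻ A C (B⊆A∪C x∈B) | x∈p∪q⁻ A B (C⊆A∪B y∈C)
  ...   | inj₂ x∈C | _        = inj₂ (inj₂ (x∈C , y∈C))
  ...   | inj₁ _   | inj₂ y∈B = inj₂ (inj₁ (x∈B , y∈B))
  ...   | inj₁ x∈A | inj₁ y∈A = inj₁ (x∈A , y∈A)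
  pair-within-one {A} {B} {C} B⊆A∪C C⊆A∪B x∈ y∈
      | inj₂ x∈C | inj₁ y∈B with x∈p∪q⁻ A B (C⊆A∪B x∈C) | x∈p∪q⁻ A C (B⊆A∪C y∈B)
  ...   | inj₂ x∈B | _        = inj₂ (inj₁ (x∈B , y∈B))
  ...   | inj₁ _   | inj₂ y∈C = inj₂ (inj₂ (x∈C , y∈C))
  ...   | inj₁ x∈A | inj₁ y∈A = inj₁ (x∈A , y∈A)

module MonotoneTransit {n : ℕ} (R : SetMap n) (transit : IsTransit R)
                       (monotone : IsMonotone R) where

  Convex : Subset n → Set
  Convex S = ∀ {p q} → p ∈ S → q ∈ S → R p q ⊆ S

  private
    variable
      a b c d p q t u v x y z : Fin n

  ∈-left : u ∈ R u v
  ∈-left {u} {v} = let (left , _ , _) = transit in left u v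

  R-sym : R u v ≡ R v u
  R-sym {u} {v} = let (_ , symmetric , _) = transit in symmetric u v

  ∈-right : v ∈ R u v
  ∈-right {v} {u} = subst (v ∈_) R-sym ∈-left

  interval-convex : Convex (R u v)
  interval-convex = monotone _ _ _ _

  uc⇒∪-convex : Axiom-uc R → Nonempty (R a b ∩ R c d) → Convex (R a b ∪ R c d)
  uc⇒∪-convex uc meet p∈ q∈ =
    let (_ , _ , _ , _ , ∪≡R) = uc _ _ _ _ meet
    in ⊆-trans (interval-convex (⊆-reflexive ∪≡R p∈) (⊆-reflexive ∪≡R q∈))
               (⊆-reflexive (sym ∪≡R))

  uc⇒u : Axiom-uc R → Axiom-u R
  uc⇒u uc u v z z∈ = ⊆-antisym
    (uc⇒∪-convex uc (z , x∈p∩q⁺ (∈-right , ∈-left))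
                 (x∈p∪q⁺ (inj₁ ∈-left)) (x∈p∪q⁺ (inj₂ ∈-right)))
    (p⊆r∧q⊆r⇒p∪q⊆r (interval-convex ∈-left z∈) (interval-convex z∈ ∈-right))

  uc⇒betweenness : Axiom-uc R → z ∉ R x y → y ∉ R x z → x ∉ R y z → ⊥
  uc⇒betweenness {z} {x} {y} uc z∉ y∉ x∉ =
    let (p , q , p∈ , q∈ , ∪≡R) = uc x y x z (x , x∈p∩q⁺ (∈-left , ∈-left))
        in-R = ⊆-reflexive ∪≡R
    in excluded (in-R (x∈p∪q⁺ (inj₁ ∈-left))) (in-R (x∈p∪q⁺ (inj₁ ∈-right)))
                (in-R (x∈p∪q⁺ (inj₂ ∈-right)))
                (pair-within-one xy⊆yz∪xz xz⊆yz∪xy p∈ q∈)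
    where
    xy⊆yz∪xz : R x y ⊆ R y z ∪ R x z
    xy⊆yz∪xz = uc⇒∪-convex uc (z , x∈p∩q⁺ (∈-right , ∈-right))
                           (x∈p∪q⁺ (inj₂ ∈-left)) (x∈p∪q⁺ (inj₁ ∈-left))

    xz⊆yz∪xy : R x z ⊆ R y z ∪ R x y
    xz⊆yz∪xy = uc⇒∪-convex uc (y , x∈p∩q⁺ (∈-left , ∈-right))
                           (x∈p∪q⁺ (inj₂ ∈-left)) (x∈p∪q⁺ (inj₁ ∈-right))

    excluded : x ∈ R p q → y ∈ R p q → z ∈ R p q →
      (p ∈ R y z × q ∈ R y z) ⊎ (p ∈ R x y × q ∈ R x y) ⊎ (p ∈ R x z × q ∈ R x z) → ⊥
    excluded x∈ _  _  (inj₁ (p∈ , q∈))        = x∉ (interval-convex p∈ q∈ x∈)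
    excluded _  _  z∈ (inj₂ (inj₁ (p∈ , q∈))) = z∉ (interval-convex p∈ q∈ z∈)
    excluded _  y∈ _  (inj₂ (inj₂ (p∈ , q∈))) = y∉ (interval-convex p∈ q∈ y∈)

  uc⇒w : Axiom-uc R → Axiom-w R
  uc⇒w uc x y z with z ∈? R x y | y ∈? R x z | x ∈? R y z
  ... | yes z∈ | _      | _      = inj₁ z∈
  ... | no _   | yes y∈ | _      = inj₂ (inj₁ y∈)
  ... | no _   | no _   | yes x∈ = inj₂ (inj₂ x∈)
  ... | no z∉  | no y∉  | no x∉  with () ← uc⇒betweenness uc z∉ y∉ x∉

  w⇒enlarge : Axiom-w R → {S : Subset n} → p ∈ S → q ∈ S → t ∈ S →
    ∃₂ λ p′ q′ → p′ ∈ S × q′ ∈ S × R p q ⊆ R p′ q′ × t ∈ R p′ q′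
  w⇒enlarge {p} {q} {t} w p∈ q∈ t∈ with w p q t
  ... | inj₁ t∈pq         = p , q , p∈ , q∈ , (λ r∈ → r∈) , t∈pq
  ... | inj₂ (inj₁ q∈pt)  = p , t , p∈ , t∈ , interval-convex ∈-left q∈pt , ∈-right
  ... | inj₂ (inj₂ p∈qt)  = q , t , q∈ , t∈ , interval-convex p∈qt ∈-left , ∈-right

  interval-to-common-point : t ∈ R x y → t ∈ R u v →
    a ∈ R x y ∪ R u v → R a t ⊆ R x y ∪ R u v
  interval-to-common-point {x = x} {y} {u = u} {v} t∈xy t∈uv a∈ with x∈p∪q⁻ (R x y) (R u v) a∈
  ... | inj₁ a∈xy = ⊆-trans (interval-convex a∈xy t∈xy) (λ r∈ → x∈p∪q⁺ (inj₁ r∈))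
  ... | inj₂ a∈uv = ⊆-trans (interval-convex a∈uv t∈uv) (λ r∈ → x∈p∪q⁺ (inj₂ r∈))

  uw⇒uc : Axiom-u R → Axiom-w R → Axiom-uc R
  uw⇒uc u-ax w-ax x y u v (t , t∈)
    with t∈xy , t∈uv ← x∈p∩q⁻ (R x y) (R u v) t∈
    with p₁ , q₁ , p₁∈ , q₁∈ , xy⊆p₁q₁ , u∈ ←
           w⇒enlarge w-ax (x∈p∪q⁺ (inj₁ ∈-left)) (x∈p∪q⁺ (inj₁ ∈-right)) (x∈p∪q⁺ (inj₂ ∈-left))
    with p , q , p∈ , q∈ , p₁q₁⊆pq , v∈ ← w⇒enlarge w-ax p₁∈ q₁∈ (x∈p∪q⁺ (inj₂ ∈-right))
    = p , q , p∈ , q∈ , ⊆-antisym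
        (p⊆r∧q⊆r⇒p∪q⊆r (⊆-trans xy⊆p₁q₁ p₁q₁⊆pq) (interval-convex (p₁q₁⊆pq u∈) v∈))
        (⊆-trans (⊆-reflexive (u-ax p q t (p₁q₁⊆pq (xy⊆p₁q₁ t∈xy))))
          (p⊆r∧q⊆r⇒p∪q⊆r (interval-to-common-point t∈xy t∈uv p∈)
                         (⊆-trans (⊆-reflexive R-sym) (interval-to-common-point t∈xy t∈uv q∈))))

mainTheorem1 : (n : ℕ) (R : SetMap (suc n)) → IsTransit R → IsMonotone R →
    (Axiom-uc R ⇔ (Axiom-u R × Axiom-w R))
mainTheorem1 n R transit monotone =
  mk⇔ (λ uc → uc⇒u uc , uc⇒w uc) (λ (u-ax , w-ax) → uw⇒uc u-ax w-ax)
  where open MonotoneTransit R transit monotone
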